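{- Let $E=(d_1,\ldots,d_{m-1})$ be a valid ordered tuple and $d=d_1+\cdots+d_{m-1}$. Then a nonnegative integer belongs to the sequence $A_E$ if and only if its base $d+1$ representation contains only the digits $0$ and $1$.
   Context: An ordered tuple $E=(d_1,\ldots,d_{m-1})$ of positive integers is written in nondecreasing order $d_1\le\cdots\le d_{m-1}$; $d=d(E)=d_1+\cdots+d_{m-1}$. $E$ is valid if $d_1=1$ and $d_l\le d_1+\cdots+d_{l-1}$ for every $2\le l\le m-1$. The sequence $A_E$ of nonnegative integers is defined greedily: $a_0=0$, and having chosen $a_0,\ldots,a_k$, $a_{k+1}$ is the least integer greater than $a_k$ such that there are no $x_1,\ldots,x_m\in\{a_0,\ldots,a_{k+1}\}$, not all the same, with $d_1x_1+\cdots+d_{m-1}x_{m-1}=dx_m$. -}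

module Defs where

open import Data.Nat using (ℕ; zero; suc; _+_; _*_; _≤_; _<_; _<ᵇ_)
open import Data.Fin using (Fin; toℕ)
open import Data.Bool using (if_then_else_)
open import Data.List using (List; []; _∷_)
open import Data.List.Relation.Unary.All using (All)
open import Data.Vec.Functional using (Vector)
open import Data.Vec.Functional as V using ()
open import Data.Product using (Σ; ∃; _×_)
open import Data.Sum using (_⊎_)
open import Relation.Binary.PropositionalEquality using (_≡_)
open import Relation.Nullary using (¬_)

-- An ordered tuple E = (d_1, …, d_{m-1}) is represented as a function
-- Fin l → ℕ with l = m - 1 (index i : Fin l stands for d_{toℕ i + 1}).

tsum : ∀ {l} → (Fin l → ℕ) → ℕ
tsum E = V.foldr _+_ 0 E

dOf : ∀ {l} → (Fin l → ℕ) → ℕ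
dOf = tsum

prefix : ∀ {l} → (Fin l → ℕ) → ℕ → ℕ
prefix E k = tsum (λ j → if toℕ j <ᵇ k then E j else 0)

wsum : ∀ {l} → (Fin l → ℕ) → (Fin l → ℕ) → ℕ
wsum E x = tsum (λ i → E i * x i)

OrderedTuple : ∀ {l} → (Fin l → ℕ) → Set
OrderedTuple E = (∀ i → 0 < E i) × (∀ i j → toℕ i ≤ toℕ j → E i ≤ E j)

-- Validity: d_1 = 1 and d_l ≤ d_1 + ⋯ + d_{l-1} for 2 ≤ l ≤ m-1.
-- (The tuple is nonempty, l = suc k, so d_1 exists.)
Valid : ∀ {k} → (Fin (suc k) → ℕ) → Set
Valid E = (E Fin.zero ≡ 1) × (∀ i → 1 ≤ toℕ i → E i ≤ prefix E (toℕ i))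
  where import Data.Fin as Fin

SolutionFree : ∀ {l} → (Fin l → ℕ) → (ℕ → Set) → Set
SolutionFree E S =
  ¬ (Σ (Fin _ → ℕ) λ x → Σ ℕ λ y →
       (∀ i → S (x i)) × S y × ¬ (∀ i → x i ≡ y) × (wsum E x ≡ dOf E * y))

Initial : (ℕ → ℕ) → ℕ → ℕ → Set
Initial a k z = Σ ℕ λ j → j ≤ k × a j ≡ z

InitialWith : (ℕ → ℕ) → ℕ → ℕ → ℕ → Set
InitialWith a k z w = Initial a k w ⊎ w ≡ z

IsGreedySeq : ∀ {l} → (Fin l → ℕ) → (ℕ → ℕ) → Set
IsGreedySeq E a =
  (a 0 ≡ 0) ×
  (∀ k → a k < a (suc k)
       × SolutionFree E (Initial a (suc k))
       × (∀ z → a k < z → z < a (suc k) → ¬ SolutionFree E (InitialWith a k z)))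

-- value of a digit list (least significant digit first) in base b
evalBase : ℕ → List ℕ → ℕ
evalBase b []       = 0
evalBase b (x ∷ xs) = x + evalBase b xs * b

Digits01 : ℕ → ℕ → Set
Digits01 b n = Σ (List ℕ) λ ds → All (λ x → x ≡ 0 ⊎ x ≡ 1) ds × evalBase b ds ≡ n

module Submission where

-- Let b = d + 1 and let S be the set of numbers whose base-b digits are all
-- 0 or 1.  The proof shows that the increasing enumeration of S is the greedy
-- sequence A_E, which is unique.
--
--  * S is solution-free.  Reducing  d_1 x_1 + ⋯ + d_{m-1} x_{m-1} = d x_m
--    modulo b, the lowest digits of the x_i contribute at most d < b, so
--    they balance d·(lowest digit of x_m) exactly, which forces them all to
--    equal it; divide by b and recurse on the remaining digits.
--  * Every z is "blocked" by S: there is a solution with x_1 = z and all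
--    other unknowns in S and at most z.  It is assembled digit by digit: a
--    digit c ≤ d is written as c·d_1 + (a subset sum of d_2, …, d_{m-1}) = d,
--    which is possible because validity makes (d_2, …, d_{m-1}) complete.
--  * A strictly increasing enumeration of a solution-free, blocking set
--    starting at 0 is greedy, and greedy sequences are unique.
-- The enumeration of S is n ↦ (binary digits of n read in base b).

open import Defs
open import Data.Nat using (ℕ; suc; _+_)
open import Data.Fin using (Fin)
open import Data.Product using (Σ; _×_)
open import Relation.Binary.PropositionalEquality using (_≡_)
open import Function.Bundles using (_⇔_)

open import Data.Nat using (zero; _*_; _∸_; _≤_; _<_; z≤n; s≤s; _≤?_; NonZero)
open import Data.Nat.Properties
open import Data.Nat.DivMod using (_%_; [m+kn]%n≡m%n; m<n⇒m%n≡m)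
open import Data.Fin using (toℕ) renaming (zero to fz; suc to fs)
open import Data.Fin.Properties using (toℕ≤pred[n])
open import Data.Digit using (Expansion; fromDigits; toDigits)
open import Data.Product using (_,_; proj₁; proj₂)
open import Data.Sum using (_⊎_; inj₁; inj₂)
open import Data.List using (List; []; _∷_)
open import Data.List.Relation.Unary.All using (All; []; _∷_)
open import Data.Empty using (⊥-elim)
open import Relation.Nullary using (¬_; yes; no)
open import Relation.Nullary.Decidable using (fromWitness)
open import Relation.Binary.PropositionalEquality
  using (refl; sym; trans; cong; cong₂; subst; module ≡-Reasoning)
open import Relation.Binary using (tri<; tri≈; tri>)
open import Function.Bundles using (mk⇔)
open import Data.Nat.Tactic.RingSolver using (solve-∀)

Bit : ℕ → Set
Bit x = x ≡ 0 ⊎ x ≡ 1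

bit≤1 : ∀ {x} → Bit x → x ≤ 1
bit≤1 (inj₁ refl) = z≤n
bit≤1 (inj₂ refl) = s≤s z≤n

tsum-cong : ∀ {l} (u v : Fin l → ℕ) → (∀ i → u i ≡ v i) → tsum u ≡ tsum v
tsum-cong {zero}  u v h = refl
tsum-cong {suc l} u v h =
  cong₂ _+_ (h fz) (tsum-cong (λ i → u (fs i)) (λ i → v (fs i)) (λ i → h (fs i)))

tsum-+ : ∀ {l} (u v : Fin l → ℕ) → tsum (λ i → u i + v i) ≡ tsum u + tsum v
tsum-+ {zero}  u v = refl
tsum-+ {suc l} u v = begin
  u fz + v fz + tsum (λ i → u (fs i) + v (fs i))
    ≡⟨ cong (u fz + v fz +_) (tsum-+ (λ i → u (fs i)) (λ i → v (fs i))) ⟩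
  u fz + v fz + (tsum (λ i → u (fs i)) + tsum (λ i → v (fs i)))
    ≡⟨ interchange (u fz) (v fz) _ _ ⟩
  u fz + tsum (λ i → u (fs i)) + (v fz + tsum (λ i → v (fs i)))  ∎
  where
  open ≡-Reasoning
  interchange : ∀ p q r s → p + q + (r + s) ≡ p + r + (q + s)
  interchange = solve-∀

tsum-*ʳ : ∀ {l} (u : Fin l → ℕ) c → tsum (λ i → u i * c) ≡ tsum u * c
tsum-*ʳ {zero}  u c = refl
tsum-*ʳ {suc l} u c =
  trans (cong (u fz * c +_) (tsum-*ʳ (λ i → u (fs i)) c)) (sym (*-distribʳ-+ c (u fz) _))

tsum-zeros : ∀ {l} → tsum {l} (λ _ → 0) ≡ 0
tsum-zeros {zero}  = refl
tsum-zeros {suc l} = tsum-zeros {l}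

wsum-zeros : ∀ {l} (E : Fin l → ℕ) → wsum E (λ _ → 0) ≡ 0
wsum-zeros {l} E = trans (tsum-cong _ _ (λ i → *-zeroʳ (E i))) (tsum-zeros {l})

wsum-ones : ∀ {l} (E : Fin l → ℕ) → wsum E (λ _ → 1) ≡ tsum E
wsum-ones E = tsum-cong _ _ (λ i → *-identityʳ (E i))

wsum-digits : ∀ {l} (E g X : Fin l → ℕ) b →
  wsum E (λ i → g i + X i * b) ≡ wsum E g + wsum E X * b
wsum-digits E g X b = begin
  wsum E (λ i → g i + X i * b)
    ≡⟨ tsum-cong _ _ (λ i → distrib (E i) (g i) (X i) b) ⟩
  tsum (λ i → E i * g i + E i * X i * b)
    ≡⟨ tsum-+ (λ i → E i * g i) (λ i → E i * X i * b) ⟩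
  wsum E g + tsum (λ i → E i * X i * b)
    ≡⟨ cong (wsum E g +_) (tsum-*ʳ (λ i → E i * X i) b) ⟩
  wsum E g + wsum E X * b  ∎
  where
  open ≡-Reasoning
  distrib : ∀ e g x b → e * (g + x * b) ≡ e * g + e * x * b
  distrib = solve-∀

wsum≡0⇒zeros : ∀ {l} (E v : Fin l → ℕ) → (∀ i → 0 < E i) →
  wsum E v ≡ 0 → ∀ i → v i ≡ 0
wsum≡0⇒zeros E v pos eq fz with m*n≡0⇒m≡0∨n≡0 (E fz) (m+n≡0⇒m≡0 _ eq)
... | inj₁ E₀≡0 = ⊥-elim (<⇒≢ (pos fz) (sym E₀≡0))
... | inj₂ v₀≡0 = v₀≡0
wsum≡0⇒zeros E v pos eq (fs i) =
  wsum≡0⇒zeros (λ j → E (fs j)) (λ j → v (fs j)) (λ j → pos (fs j))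
    (m+n≡0⇒n≡0 (E fz * v fz) eq) i

wsum-bits≤tsum : ∀ {l} (E v : Fin l → ℕ) → (∀ i → Bit (v i)) → wsum E v ≤ tsum E
wsum-bits≤tsum E v bits = begin
  wsum E v               ≤⟨ wsum-monoʳ E v (λ _ → 1) (λ i → bit≤1 (bits i)) ⟩
  wsum E (λ _ → 1)       ≡⟨ wsum-ones E ⟩
  tsum E                 ∎
  where
  open ≤-Reasoning
  wsum-monoʳ : ∀ {l} (E u v : Fin l → ℕ) → (∀ i → u i ≤ v i) → wsum E u ≤ wsum E v
  wsum-monoʳ {zero}  E u v h = z≤n
  wsum-monoʳ {suc l} E u v h = +-mono-≤ (*-monoʳ-≤ (E fz) (h fz))
    (wsum-monoʳ (λ j → E (fs j)) (λ j → u (fs j)) (λ j → v (fs j)) (λ j → h (fs j)))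

wsum≡tsum⇒ones : ∀ {l} (E v : Fin l → ℕ) → (∀ i → 0 < E i) → (∀ i → Bit (v i)) →
  wsum E v ≡ tsum E → ∀ i → v i ≡ 1
wsum≡tsum⇒ones E v pos bits eq i = one (bits i) (complement-zero i)
  where
  one : ∀ {x} → Bit x → 1 ∸ x ≡ 0 → x ≡ 1
  one (inj₂ x≡1) _ = x≡1
  one (inj₁ refl) ()
  split : wsum E v + wsum E (λ j → 1 ∸ v j) ≡ tsum E
  split = trans (sym (tsum-+ (λ j → E j * v j) (λ j → E j * (1 ∸ v j)))) (tsum-cong _ _ λ j → begin
    E j * v j + E j * (1 ∸ v j)   ≡⟨ sym (*-distribˡ-+ (E j) (v j) _) ⟩
    E j * (v j + (1 ∸ v j))       ≡⟨ cong (E j *_) (m+[n∸m]≡n (bit≤1 (bits j))) ⟩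
    E j * 1                       ≡⟨ *-identityʳ (E j) ⟩
    E j                           ∎)
    where open ≡-Reasoning
  complement-zero : ∀ j → 1 ∸ v j ≡ 0
  complement-zero = wsum≡0⇒zeros E (λ j → 1 ∸ v j) pos
    (+-cancelˡ-≡ (tsum E) _ 0
      (trans (cong (_+ wsum E (λ j → 1 ∸ v j)) (sym eq)) (trans split (sym (+-identityʳ _)))))

digit-unique : ∀ {b} .{{_ : NonZero b}} {A B C D} → A < b → C < b →
  A + B * b ≡ C + D * b → A ≡ C × B ≡ D
digit-unique {b} {A} {B} {C} {D} A<b C<b eq = A≡C , *-cancelʳ-≡ B D b (+-cancelˡ-≡ A _ _ eq′)
  where
  open ≡-Reasoning
  A≡C : A ≡ C
  A≡C = begin
    A                ≡⟨ sym (m<n⇒m%n≡m A<b) ⟩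
    A % b            ≡⟨ sym ([m+kn]%n≡m%n A B b) ⟩
    (A + B * b) % b  ≡⟨ cong (_% b) eq ⟩
    (C + D * b) % b  ≡⟨ [m+kn]%n≡m%n C D b ⟩
    C % b            ≡⟨ m<n⇒m%n≡m C<b ⟩
    C                ∎
  eq′ : A + B * b ≡ A + D * b
  eq′ = trans eq (cong (_+ D * b) (sym A≡C))

digits01-split : ∀ {b n} → Digits01 b n →
  Σ ℕ λ ε → Σ ℕ λ n′ → Bit ε × Digits01 b n′ × n ≡ ε + n′ * b
digits01-split ([] , [] , refl) = 0 , 0 , inj₁ refl , ([] , [] , refl) , refl
digits01-split {b} (x ∷ xs , p ∷ ps , refl) = x , evalBase b xs , p , (xs , ps , refl) , refl

digits01-∷ : ∀ {b ε n} → Bit ε → Digits01 b n → Digits01 b (ε + n * b)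
digits01-∷ {b} {ε} p (ds , ps , eq) = ε ∷ ds , p ∷ ps , cong (λ t → ε + t * b) eq

digits01-0 : ∀ {b} → Digits01 b 0
digits01-0 = [] , [] , refl

-- Induction absorbs F 0 into s.
subset-sum : ∀ {n} (F : Fin n → ℕ) s → (∀ i → F i ≤ suc (s + prefix F (toℕ i))) →
  ∀ t → t ≤ s + tsum F →
  Σ ℕ λ u → Σ (Fin n → ℕ) λ e → u ≤ s × (∀ i → Bit (e i)) × u + wsum F e ≡ t
subset-sum {zero} F s h t t≤ = t , (λ ()) , subst (t ≤_) (+-identityʳ s) t≤ , (λ ()) , +-identityʳ t
subset-sum {suc n} F s h t t≤
  with subset-sum F′ (s + F fz) (λ i → subst (F′ i ≤_) (cong suc (sym (+-assoc s _ _))) (h (fs i)))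
                  t (subst (t ≤_) (sym (+-assoc s (F fz) _)) t≤)
  where F′ = λ j → F (fs j)
... | u , e , u≤ , e-bits , eq with u ≤? s
... | yes u≤s = u , (λ { fz → 0 ; (fs i) → e i }) , u≤s , (λ { fz → inj₁ refl ; (fs i) → e-bits i }) ,
  trans (cong (λ w → u + (w + wsum (λ j → F (fs j)) e)) (*-zeroʳ (F fz))) eq
... | no u≰s = u ∸ F fz , (λ { fz → 1 ; (fs i) → e i }) , u∸F₀≤s ,
  (λ { fz → inj₂ refl ; (fs i) → e-bits i }) , eq′
  where
  W = wsum (λ j → F (fs j)) e
  F₀≤u : F fz ≤ u
  F₀≤u = ≤-trans (h fz)
    (subst (_≤ u) (cong suc (sym (trans (cong (s +_) (tsum-zeros {suc n})) (+-identityʳ s)))) (≰⇒> u≰s))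
  u∸F₀≤s : u ∸ F fz ≤ s
  u∸F₀≤s = ≤-trans (∸-monoˡ-≤ (F fz) u≤) (≤-reflexive (m+n∸n≡m s (F fz)))
  eq′ : u ∸ F fz + (F fz * 1 + W) ≡ t
  eq′ = begin
    u ∸ F fz + (F fz * 1 + W)  ≡⟨ cong (λ w → u ∸ F fz + (w + W)) (*-identityʳ (F fz)) ⟩
    u ∸ F fz + (F fz + W)      ≡⟨ sym (+-assoc (u ∸ F fz) (F fz) W) ⟩
    u ∸ F fz + F fz + W        ≡⟨ cong (_+ W) (m∸n+n≡m F₀≤u) ⟩
    u + W                      ≡⟨ eq ⟩
    t                          ∎
    where open ≡-Reasoning

-- Binary counting: bits n is the list of binary digits of n, least
-- significant first, and inc adds one to such a list.

inc : List ℕ → List ℕ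
inc []           = 1 ∷ []
inc (zero ∷ xs)  = 1 ∷ xs
inc (suc _ ∷ xs) = 0 ∷ inc xs

bits : ℕ → List ℕ
bits zero    = []
bits (suc n) = inc (bits n)

-- Multiplication by the base (shift by one position, keeping [] as zero).
shift : List ℕ → List ℕ
shift []       = []
shift (x ∷ xs) = 0 ∷ x ∷ xs

shift-inc : ∀ ds → shift (inc ds) ≡ 0 ∷ inc ds
shift-inc []           = refl
shift-inc (zero ∷ ds)  = refl
shift-inc (suc _ ∷ ds) = refl

bits-double : ∀ j → bits (j * 2) ≡ shift (bits j) × bits (suc (j * 2)) ≡ 1 ∷ bits j
bits-double zero = refl , refl
bits-double (suc j) with bits-double j
... | _ , odd = even′ , trans (cong inc even′) (cong inc (shift-inc (bits j)))
  where
  even′ : bits (suc (suc (j * 2))) ≡ shift (bits (suc j))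
  even′ = trans (cong inc odd) (sym (shift-inc (bits j)))

bits-Bit : ∀ n → All Bit (bits n)
bits-Bit zero    = []
bits-Bit (suc n) = inc-Bit (bits-Bit n)
  where
  inc-Bit : ∀ {ds} → All Bit ds → All Bit (inc ds)
  inc-Bit []                = inj₂ refl ∷ []
  inc-Bit (inj₁ refl ∷ ps) = inj₂ refl ∷ ps
  inc-Bit (inj₂ refl ∷ ps) = inj₁ refl ∷ inc-Bit ps

evalBase-inc : ∀ b → 2 ≤ b → ∀ {ds} → All Bit ds → evalBase b ds < evalBase b (inc ds)
evalBase-inc b 2≤b []               = s≤s z≤n
evalBase-inc b 2≤b (inj₁ refl ∷ ps) = ≤-refl
evalBase-inc b 2≤b {_ ∷ xs} (inj₂ refl ∷ ps) =
  ≤-trans (+-monoˡ-≤ (evalBase b xs * b) 2≤b) (*-monoˡ-≤ b (evalBase-inc b 2≤b ps))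

bits-onto : ∀ b {ds} → All Bit ds → Σ ℕ λ j → evalBase b (bits j) ≡ evalBase b ds
bits-onto b [] = 0 , refl
bits-onto b (inj₁ refl ∷ ps) with bits-onto b ps
... | j , eq = j * 2 ,
  trans (cong (evalBase b) (proj₁ (bits-double j))) (trans (shift-value (bits j)) (cong (_* b) eq))
  where
  shift-value : ∀ ds → evalBase b (shift ds) ≡ evalBase b ds * b
  shift-value []       = refl
  shift-value (_ ∷ _) = refl
bits-onto b (inj₂ refl ∷ ps) with bits-onto b ps
... | j , eq = suc (j * 2) , trans (cong (evalBase b) (proj₂ (bits-double j))) (cong (λ t → 1 + t * b) eq)

module StrictlyIncreasing (a : ℕ → ℕ) (step : ∀ n → a n < a (suc n)) where

  mono : ∀ {i j} → i < j → a i < a j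
  mono {i} {suc j} (s≤s i≤j) with m≤n⇒m<n∨m≡n i≤j
  ... | inj₁ i<j  = <-trans (mono i<j) (step j)
  ... | inj₂ refl = step j

  reflect : ∀ {i j} → a i < a j → i < j
  reflect {i} {j} ai<aj with <-cmp i j
  ... | tri< i<j _ _ = i<j
  ... | tri≈ _ refl _ = ⊥-elim (<-irrefl refl ai<aj)
  ... | tri> _ _ j<i = ⊥-elim (<-asym ai<aj (mono j<i))

SolutionFree-⊆ : ∀ {l} (E : Fin l → ℕ) {P Q : ℕ → Set} → (∀ n → P n → Q n) →
  SolutionFree E Q → SolutionFree E P
SolutionFree-⊆ E P⊆Q free (x , y , px , py , ne , eq) =
  free (x , y , (λ i → P⊆Q _ (px i)) , P⊆Q _ py , ne , eq)

-- Two greedy sequences agree.  If they agree up to k, the smaller of their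
-- next terms would have been admissible for the other one.
module _ {l} (E : Fin l → ℕ) where

  AgreeUpTo : (ℕ → ℕ) → (ℕ → ℕ) → ℕ → Set
  AgreeUpTo a a′ k = ∀ j → j ≤ k → a j ≡ a′ j

  greedy-no-undercut : ∀ {a a′} → IsGreedySeq E a → IsGreedySeq E a′ → ∀ k →
    AgreeUpTo a a′ k → ¬ (a′ (suc k) < a (suc k))
  greedy-no-undercut {a} {a′} (_ , greedy) (_ , greedy′) k agree a′<a =
    proj₂ (proj₂ (greedy k)) (a′ (suc k)) aₖ<a′ a′<a
      (SolutionFree-⊆ E included (proj₁ (proj₂ (greedy′ k))))
    where
    aₖ<a′ : a k < a′ (suc k)
    aₖ<a′ = subst (_< a′ (suc k)) (sym (agree k ≤-refl)) (proj₁ (greedy′ k))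
    included : ∀ w → InitialWith a k (a′ (suc k)) w → Initial a′ (suc k) w
    included w (inj₁ (j , j≤k , refl)) = j , m≤n⇒m≤1+n j≤k , sym (agree j j≤k)
    included w (inj₂ refl)             = suc k , ≤-refl , refl

  greedy-unique : ∀ {a a′} → IsGreedySeq E a → IsGreedySeq E a′ → ∀ k → AgreeUpTo a a′ k
  greedy-unique (a₀ , _) (a′₀ , _) zero zero z≤n = trans a₀ (sym a′₀)
  greedy-unique {a} {a′} g g′ (suc k) j j≤ with m≤n⇒m<n∨m≡n j≤
  ... | inj₁ (s≤s j≤k) = greedy-unique g g′ k j j≤k
  ... | inj₂ refl with <-cmp (a (suc k)) (a′ (suc k))
  ... | tri≈ _ eq _ = eq
  ... | tri< a<a′ _ _ =
    ⊥-elim (greedy-no-undercut g′ g k (λ i i≤ → sym (greedy-unique g g′ k i i≤)) a<a′)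
  ... | tri> _ _ a′<a = ⊥-elim (greedy-no-undercut g g′ k (greedy-unique g g′ k) a′<a)

Blocking : ∀ {k} → (Fin (suc k) → ℕ) → (ℕ → Set) → ℕ → Set
Blocking E S z = Σ (Fin _ → ℕ) λ x → Σ ℕ λ y →
  x fz ≡ z × (∀ i → S (x (fs i)) × x (fs i) ≤ z) × (S y × y ≤ z) × wsum E x ≡ dOf E * y

module EnumerationIsGreedy {k} (E : Fin (suc k) → ℕ) (S : ℕ → Set) (a : ℕ → ℕ)
  (a₀ : a 0 ≡ 0) (step : ∀ n → a n < a (suc n))
  (a∈S : ∀ n → S (a n)) (S⊆a : ∀ {n} → S n → Σ ℕ λ j → a j ≡ n)
  (free : SolutionFree E S) (blocked : ∀ z → ¬ S z → Blocking E S z) where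

  open StrictlyIncreasing a step

  below-is-initial : ∀ {n w} → S w → w < a (suc n) → Initial a n w
  below-is-initial {n} sw w<a with S⊆a sw
  ... | j , refl = j , ≤-pred (reflect w<a) , refl

  gap-outside : ∀ {n z} → a n < z → z < a (suc n) → ¬ S z
  gap-outside a<z z<a sz with S⊆a sz
  ... | j , refl = <-irrefl refl (≤-trans (reflect z<a) (reflect a<z))

  gap-blocked : ∀ n z → a n < z → z < a (suc n) → ¬ SolutionFree E (InitialWith a n z)
  gap-blocked n z a<z z<a free′ with blocked z (gap-outside a<z z<a)
  ... | x , y , x₀≡z , xs , (sy , y≤z) , eq = free′ (x , y , member , member-y , not-constant , eq)
    where
    earlier : ∀ {w} → S w → w ≤ z → Initial a n w
    earlier sw w≤z =
      below-is-initial sw (<-trans (≤∧≢⇒< w≤z λ { refl → gap-outside a<z z<a sw }) z<a)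
    member : ∀ i → InitialWith a n z (x i)
    member fz     = inj₂ x₀≡z
    member (fs i) = inj₁ (earlier (proj₁ (xs i)) (proj₂ (xs i)))
    member-y : InitialWith a n z y
    member-y = inj₁ (earlier sy y≤z)
    not-constant : ¬ (∀ i → x i ≡ y)
    not-constant all≡y = gap-outside a<z z<a (subst S (trans (sym (all≡y fz)) x₀≡z) sy)

  greedy : IsGreedySeq E a
  greedy = a₀ , λ n → step n , SolutionFree-⊆ E (λ { w (j , _ , refl) → a∈S j }) free , gap-blocked n

module ValidTuple {k} (E : Fin (suc k) → ℕ) (pos : ∀ i → 0 < E i) (E₀≡1 : E fz ≡ 1)
  (valid : ∀ i → 1 ≤ toℕ i → E i ≤ prefix E (toℕ i)) where

  d = tsum E
  b = suc d
  tail = λ (j : Fin k) → E (fs j)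

  d≡1+tail : d ≡ suc (tsum tail)
  d≡1+tail = cong (_+ tsum tail) E₀≡1

  1≤d : 1 ≤ d
  1≤d = ≤-trans (pos fz) (m≤m+n (E fz) (tsum tail))

  S : ℕ → Set
  S = Digits01 b

  -- Validity says exactly that the tail (d_2, …, d_{m-1}) is complete
  -- starting from the available sum d_1 = 1.
  tail-complete : ∀ i → tail i ≤ suc (0 + prefix tail (toℕ i))
  tail-complete i = subst (tail i ≤_) (cong (_+ prefix tail (toℕ i)) E₀≡1) (valid (fs i) (s≤s z≤n))

  -- Every single digit c ≤ d is blocked by the bits: c·d_1 + (a subset sum
  -- of the tail) = d · 1 for c ≥ 2, and the constant solutions for c ≤ 1.
  digit-blocked : ∀ c → c ≤ d → Blocking E Bit c
  digit-blocked zero _ =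
    (λ _ → 0) , 0 , refl , (λ _ → inj₁ refl , z≤n) , (inj₁ refl , z≤n) ,
    trans (wsum-zeros E) (sym (*-zeroʳ d))
  digit-blocked (suc zero) _ =
    (λ _ → 1) , 1 , refl , (λ _ → inj₂ refl , ≤-refl) , (inj₂ refl , ≤-refl) ,
    trans (wsum-ones E) (sym (*-identityʳ d))
  digit-blocked c@(suc (suc _)) c≤d
    with subset-sum tail 0 tail-complete (d ∸ c)
           (≤-trans (∸-monoʳ-≤ d (s≤s z≤n)) (≤-reflexive (cong (_∸ 1) d≡1+tail)))
  ... | suc _ , _ , () , _
  ... | zero , e , _ , e-bits , eq = x , 1 , refl , (λ i → e-bits i , ≤-trans (bit≤1 (e-bits i)) (s≤s z≤n)) ,
    (inj₂ refl , s≤s z≤n) , sum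
    where
    x : Fin (suc k) → ℕ
    x fz     = c
    x (fs i) = e i
    sum : wsum E x ≡ d * 1
    sum = begin
      E fz * c + wsum tail e  ≡⟨ cong (λ w → w * c + wsum tail e) E₀≡1 ⟩
      c + 0 + wsum tail e     ≡⟨ cong (_+ wsum tail e) (+-identityʳ c) ⟩
      c + wsum tail e         ≡⟨ cong (c +_) eq ⟩
      c + (d ∸ c)             ≡⟨ m+[n∸m]≡n c≤d ⟩
      d                       ≡⟨ sym (*-identityʳ d) ⟩
      d * 1                   ∎
      where open ≡-Reasoning

  blocked-∷ : ∀ {c z} → Blocking E Bit c → Blocking E S z → Blocking E S (c + z * b)
  blocked-∷ {c} {z} (g , f , g₀ , gs , (f-bit , f≤c) , g-eq) (X , Y , X₀ , Xs , (Y∈S , Y≤z) , X-eq) =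
    (λ i → g i + X i * b) , f + Y * b , cong₂ (λ u v → u + v * b) g₀ X₀ ,
    (λ i → digits01-∷ (proj₁ (gs i)) (proj₁ (Xs i)) , combine (proj₂ (gs i)) (proj₂ (Xs i))) ,
    (digits01-∷ f-bit Y∈S , combine f≤c Y≤z) , sum
    where
    combine : ∀ {u v} → u ≤ c → v ≤ z → u + v * b ≤ c + z * b
    combine u≤c v≤z = +-mono-≤ u≤c (*-monoˡ-≤ b v≤z)
    open ≡-Reasoning
    sum : wsum E (λ i → g i + X i * b) ≡ d * (f + Y * b)
    sum = begin
      wsum E (λ i → g i + X i * b)  ≡⟨ wsum-digits E g X b ⟩
      wsum E g + wsum E X * b       ≡⟨ cong₂ (λ u v → u + v * b) g-eq X-eq ⟩
      d * f + d * Y * b             ≡⟨ regroup d f Y b ⟩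
      d * (f + Y * b)               ∎
      where
      regroup : ∀ d f Y b → d * f + d * Y * b ≡ d * (f + Y * b)
      regroup = solve-∀

  S-blocks : ∀ z → Blocking E S z
  S-blocks z with toDigits b {fromWitness (s≤s 1≤d)} z
  ... | ds , refl = go ds
    where
    go : (ds : Expansion b) → Blocking E S (fromDigits ds)
    go [] = (λ _ → 0) , 0 , refl , (λ _ → digits01-0 , z≤n) , (digits01-0 , z≤n) ,
      trans (wsum-zeros E) (sym (*-zeroʳ d))
    go (c ∷ cs) = blocked-∷ (digit-blocked (toℕ c) (toℕ≤pred[n] c)) (go cs)

  lowest-digits : ∀ (ε x′ : Fin (suc k) → ℕ) → (∀ i → Bit (ε i)) → ∀ {δ Y} → Bit δ →
    wsum E (λ i → ε i + x′ i * b) ≡ d * (δ + Y * b) →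
    (∀ i → ε i ≡ δ) × wsum E x′ ≡ d * Y
  lowest-digits ε x′ ε-bits {δ} {Y} δ-bit eq = forced δ-bit (proj₁ split) , proj₂ split
    where
    spread : ∀ d δ Y b → d * (δ + Y * b) ≡ d * δ + d * Y * b
    spread = solve-∀
    split : wsum E ε ≡ d * δ × wsum E x′ ≡ d * Y
    split = digit-unique (s≤s (wsum-bits≤tsum E ε ε-bits))
      (s≤s (≤-trans (*-monoʳ-≤ d (bit≤1 δ-bit)) (≤-reflexive (*-identityʳ d))))
      (trans (sym (wsum-digits E ε x′ b)) (trans eq (spread d δ Y b)))
    forced : ∀ {δ} → Bit δ → wsum E ε ≡ d * δ → ∀ i → ε i ≡ δ
    forced (inj₁ refl) e = wsum≡0⇒zeros E ε pos (trans e (*-zeroʳ d))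
    forced (inj₂ refl) e = wsum≡tsum⇒ones E ε pos ε-bits (trans e (*-identityʳ d))

  S-rigid : ∀ ds → All Bit ds → ∀ (x : Fin (suc k) → ℕ) → (∀ i → S (x i)) →
    wsum E x ≡ d * evalBase b ds → ∀ i → x i ≡ evalBase b ds
  S-rigid [] [] x xs eq = wsum≡0⇒zeros E x pos (trans eq (*-zeroʳ d))
  S-rigid (δ ∷ ds) (δ-bit ∷ ps) x xs eq i = begin
    x i                  ≡⟨ x≡ i ⟩
    ε i + x′ i * b
      ≡⟨ cong₂ (λ u v → u + v * b) (proj₁ low i) (S-rigid ds ps x′ xs′ (proj₂ low) i) ⟩
    δ + evalBase b ds * b  ∎
    where
    open ≡-Reasoning
    ε x′ : Fin (suc k) → ℕ
    ε  i = proj₁ (digits01-split (xs i))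
    x′ i = proj₁ (proj₂ (digits01-split (xs i)))
    ε-bits : ∀ i → Bit (ε i)
    ε-bits i = proj₁ (proj₂ (proj₂ (digits01-split (xs i))))
    xs′ : ∀ i → S (x′ i)
    xs′ i = proj₁ (proj₂ (proj₂ (proj₂ (digits01-split (xs i)))))
    x≡ : ∀ i → x i ≡ ε i + x′ i * b
    x≡ i = proj₂ (proj₂ (proj₂ (proj₂ (digits01-split (xs i)))))
    low = lowest-digits ε x′ ε-bits δ-bit (trans (tsum-cong _ _ (λ j → cong (E j *_) (sym (x≡ j)))) eq)

  S-free : SolutionFree E S
  S-free (x , y , xs , (ds , ps , refl) , not-constant , eq) = not-constant (S-rigid ds ps x xs eq)

  seq : ℕ → ℕ
  seq n = evalBase b (bits n)

  seq-greedy : IsGreedySeq E seq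
  seq-greedy = EnumerationIsGreedy.greedy E S seq refl
    (λ n → evalBase-inc b (s≤s 1≤d) (bits-Bit n)) (λ n → bits n , bits-Bit n , refl)
    (λ { (ds , ps , refl) → bits-onto b ps }) S-free (λ z _ → S-blocks z)

  greedy-range : ∀ a → IsGreedySeq E a → ∀ n → (Σ ℕ λ j → a j ≡ n) ⇔ S n
  greedy-range a g n = mk⇔
    (λ { (j , refl) → subst S (same j) (bits j , bits-Bit j , refl) })
    (λ { (ds , ps , refl) → let (j , eq) = bits-onto b ps in j , trans (sym (same j)) eq })
    where
    same : ∀ j → seq j ≡ a j
    same j = greedy-unique E seq-greedy g j j ≤-refl

theorem2 : ∀ {k} (E : Fin (suc k) → ℕ) → OrderedTuple E → Valid E →
    (Σ (ℕ → ℕ) λ a → IsGreedySeq E a) ×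
    (∀ (a : ℕ → ℕ) → IsGreedySeq E a →
       ∀ n → (Σ ℕ λ j → a j ≡ n) ⇔ Digits01 (dOf E + 1) n)
theorem2 E (pos , _) (E₀≡1 , valid) =
  (seq , seq-greedy) ,
  λ a g n → subst (λ b → (Σ ℕ λ j → a j ≡ n) ⇔ Digits01 b n)
                  (+-comm 1 (dOf E)) (greedy-range a g n)
  where open ValidTuple E pos E₀≡1 valid
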